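{- For every integer $n\geq 0$, the generating polynomial of the $n$-twist knot shadow $\tau_n$ is \[ \tau_n(x)=2(1+x)^{n+1}+x^3+2x^2-x-2 . \]
   Context: A shadow is a finite union of closed curves in the plane (or sphere) in general position: finitely many self-intersections, called crossings, all transverse double points. At a crossing, splitting means deleting a small neighbourhood of the crossing and reconnecting the four loose ends by two disjoint arcs; there are two ways to do this. A state of a shadow with $m$ crossings is the result of splitting every crossing in one of the two ways ($2^m$ states in total); it is a disjoint union of simple closed curves, and $|S|$ denotes the number of these curves. The generating polynomial of a shadow $D$ is $D(x)=\sum_S x^{|S|}$, the sum over all $2^m$ states. For $n\ge 0$, a horizontal twist region $R_n$ consists of two strands running from left to right which cross each other $n$ times consecutively (for $n=0$: two parallel horizontal segments). The $n$-twist knot shadow $\tau_n$ is the standard twist-knot shadow with $n+2$ crossings: the twist region $R_n$ whose ends are closed up through a clasp consisting of two further crossings. Equivalently, take the closed curve obtained from $R_n$ by joining its two left ends by an arc and its two right ends by an arc (a single closed curve with $n$ crossings in a row bounding $n+1$ lobes; for $n=0$ a circle), and hook its leftmost and rightmost lobes (for $n=0$: two opposite arcs of the circle) through each other so that they cross in exactly two new crossings. For example, $\tau_1$ is the standard trefoil shadow and $\tau_2$ is the standard figure-eight shadow. -}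

module Defs where

open import Data.Bool using (Bool; true; false; if_then_else_)
open import Data.Nat using (ℕ; zero; suc; _+_; _∸_; _≡ᵇ_)
import Data.Nat.Properties as ℕP
open import Data.Integer using (ℤ; _^_) renaming (_+_ to _+ℤ_)
open import Data.List using (List; []; _∷_; _++_; map; length; foldl; upTo; concat; zipWith)
open import Data.List.Base using (deduplicate)
open import Data.Product using (_×_; _,_)
open import Function using (id)

-- A shadow, encoded combinatorially (a "planar diagram code" without
-- over/under information).  The shadow is a 4-regular plane multigraph whose
-- vertices are the crossings.  Its edges (arcs of the curves running between
-- consecutive crossings) are labelled 0 , 1 , … , edges - 1.  Each crossing is
-- the 4-tuple (a , b , c , d) of the labels of the four edge-ends meeting at
-- it, listed in cyclic (counterclockwise) order around the crossing; the
-- curve passes straight through, i.e. a continues as c and b as d.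
-- (An edge forming a loop at a crossing appears twice in that tuple.)
Crossing : Set
Crossing = ℕ × ℕ × ℕ × ℕ

record Shadow : Set where
  constructor shadow
  field
    edges     : ℕ
    crossings : List Crossing
open Shadow public

-- Splitting a crossing (a , b , c , d): the two ways reconnect the four loose
-- ends by two disjoint arcs, i.e. join cyclically adjacent ends:
--   true  : a–b and c–d ,     false : a–d and b–c .
split : Crossing → Bool → List (ℕ × ℕ)
split (a , b , c , d) true  = (a , b) ∷ (c , d) ∷ []
split (a , b , c , d) false = (a , d) ∷ (b , c) ∷ []

-- A state is a choice of splitting at every crossing (a list of Bools, one per
-- crossing, in the order of `crossings`).  All 2^m states:
allStates : ℕ → List (List Bool)
allStates zero    = [] ∷ []
allStates (suc m) = map (true ∷_) (allStates m) ++ map (false ∷_) (allStates m)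

mergeLink : (ℕ → ℕ) → ℕ × ℕ → (ℕ → ℕ)
mergeLink lab (u , v) w = if lab w ≡ᵇ lab v then lab u else lab w

components : ℕ → List (ℕ × ℕ) → ℕ
components e links =
  length (deduplicate ℕP._≟_ (map (foldl mergeLink id links) (upTo e)))

-- After splitting,
-- each resulting curve is a cyclic chain of edges glued at the split
-- crossings, so curves = connected components of the edges under the gluing.
stateCurves : Shadow → List Bool → ℕ
stateCurves D s = components (edges D) (concat (zipWith split (crossings D) s))

sumℤ : List ℤ → ℤ
sumℤ = foldl _+ℤ_ (Data.Integer.+ 0)

genPoly : Shadow → ℤ → ℤ
genPoly D x = sumℤ (map (λ s → x ^ stateCurves D s) (allStates (length (crossings D))))

-- Twist region R_n with crossings c_1 … c_n from left to right; between
-- c_i and c_{i+1} (c_0 / c_{n+1} = left / right ends) run an upper edge U i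
-- and a lower edge L i (i = 0 … n).  The left lobe (U 0, left cap, L 0) and
-- the right lobe (U n, right cap, L n) are hooked: the two caps cross at two
-- points q (inner) and p (outer); the left cap runs U 0 → q → E → p → L 0, the
-- right cap runs U n → q → F → p → L n.  Cyclic orders:
--   c_i : (L (i-1), L i, U i, U (i-1))
--   q   : (U 0, U n, E, F)
--   p   : (E, L n, L 0, F)
-- For n = 0 this degenerates correctly (U 0 = U n, L 0 = L n are loops).
module TwistLabels (n : ℕ) where
  U : ℕ → ℕ
  U i = i
  L : ℕ → ℕ
  L i = suc n + i
  E F : ℕ
  E = 2 + n + n
  F = 3 + n + n

twistCrossings : ℕ → ℕ → List Crossing
twistCrossings n zero    = []
twistCrossings n (suc k) = twistCrossings n k ∷ʳ' (L k , L (suc k) , U (suc k) , U k)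
  where
  open TwistLabels n
  _∷ʳ'_ : List Crossing → Crossing → List Crossing
  xs ∷ʳ' x = xs ++ x ∷ []

τ : ℕ → Shadow
τ n = shadow (4 + n + n)
             ((U 0 , U n , E , F) ∷ (E , L n , L 0 , F) ∷ twistCrossings n n)
  where open TwistLabels n

module Submission where

-- As a
-- state has exactly as many links as τ n has edges, the number of components
-- equals the number of redundant links: links joining two edges already
-- connected by the links processed before them (Counting).  The two clasp crossings come first; they are
-- handled by transporting an evaluated computation on six vertices along an
-- injective renaming (Renaming, Clasp).  Then the twist crossings follow one
-- at a time: the loose ends of the unprocessed part of the region are always
-- connected in one of two patterns, and each crossing changes the pattern and
-- the count in a fixed way (TwistCrossing, TwistRegion).  Summing x^|S| over
-- the states yields a recursion in the length of the twist region, solved in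
-- closed form (StateSums); the theorem adds up the four clasp states, and
-- τ 0 is checked by evaluation.

open import Defs
open import Data.Nat using (ℕ)

module Splitting where

  open import Data.Bool using (Bool; true; false)
  open import Data.Nat using (suc; _+_)
  open import Data.Nat.Properties using (+-suc; suc-injective)
  open import Data.List using (List; []; _∷_; _++_; length; concat; zipWith)
  open import Data.List.Properties using (length-++)
  open import Data.List.Relation.Unary.All using (All; []; _∷_)
  open import Data.List.Relation.Unary.All.Properties using (++⁺)
  open import Data.Product using (_×_; _,_)
  open import Relation.Binary.PropositionalEquality

  Ends : (ℕ → Set) → Crossing → Set
  Ends P (a , b , c , d) = P a × P b × P c × P d

  Both : (ℕ → Set) → ℕ × ℕ → Set
  Both P (u , v) = P u × P v

  stateLinks : List Crossing → List Bool → List (ℕ × ℕ)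
  stateLinks cs t = concat (zipWith split cs t)

  ends-map : ∀ {P Q : ℕ → Set} → (∀ {x} → P x → Q x) → ∀ {cr} → Ends P cr → Ends Q cr
  ends-map f (pa , pb , pc , pd) = f pa , f pb , f pc , f pd

  split-all : ∀ {P} cr s → Ends P cr → All (Both P) (split cr s)
  split-all (a , b , c , d) true  (pa , pb , pc , pd) = (pa , pb) ∷ (pc , pd) ∷ []
  split-all (a , b , c , d) false (pa , pb , pc , pd) = (pa , pd) ∷ (pb , pc) ∷ []

  stateLinks-all : ∀ {P} cs t → All (Ends P) cs → All (Both P) (stateLinks cs t)
  stateLinks-all []       t        []           = []
  stateLinks-all (c ∷ cs) []       (pc ∷ pcs)   = []
  stateLinks-all (c ∷ cs) (s ∷ t)  (pc ∷ pcs)   = ++⁺ (split-all c s pc) (stateLinks-all cs t pcs)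

  split-length : ∀ cr s → length (split cr s) ≡ 2
  split-length (a , b , c , d) true  = refl
  split-length (a , b , c , d) false = refl

  stateLinks-length : ∀ cs t → length t ≡ length cs → length (stateLinks cs t) ≡ length cs + length cs
  stateLinks-length []       []      _   = refl
  stateLinks-length (c ∷ cs) (s ∷ t) len = begin
    length (split c s ++ stateLinks cs t)           ≡⟨ length-++ (split c s) ⟩
    length (split c s) + length (stateLinks cs t)   ≡⟨ cong₂ _+_ (split-length c s)
                                                         (stateLinks-length cs t (suc-injective len)) ⟩
    suc (suc (k + k))                               ≡⟨ cong suc (sym (+-suc k k)) ⟩
    suc k + suc k                                   ∎
    where
    open ≡-Reasoning
    k = length cs

module Merging where

  open Splitting
  open import Data.Bool using (true; false)
  open import Data.Nat using (_≡ᵇ_)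
  open import Data.Nat.Properties using (_≟_)
  open import Data.Empty using (⊥-elim)
  open import Data.List using ([]; _∷_; foldl)
  open import Data.List.Relation.Unary.All using (All; []; _∷_)
  open import Data.Product using (_,_)
  open import Function using (_∘_)
  open import Relation.Nullary using (¬_; yes; no)
  open import Relation.Nullary.Decidable using (dec-true; dec-false)
  open import Relation.Binary.PropositionalEquality

  ≡ᵇ-yes : ∀ {p q} → p ≡ q → (p ≡ᵇ q) ≡ true
  ≡ᵇ-yes {p} {q} = dec-true (p ≟ q)

  ≡ᵇ-no : ∀ {p q} → ¬ p ≡ q → (p ≡ᵇ q) ≡ false
  ≡ᵇ-no {p} {q} = dec-false (p ≟ q)

  module _ (f : ℕ → ℕ) (u v : ℕ) where

    merge-hit : ∀ y → f y ≡ f v → mergeLink f (u , v) y ≡ f u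
    merge-hit y y~v rewrite ≡ᵇ-yes y~v = refl

    merge-miss : ∀ y → ¬ f y ≡ f v → mergeLink f (u , v) y ≡ f y
    merge-miss y y≁v rewrite ≡ᵇ-no y≁v = refl

    merge-cong : ∀ y z → f y ≡ f z → mergeLink f (u , v) y ≡ mergeLink f (u , v) z
    merge-cong y z y~z rewrite y~z = refl

    merge-redundant : f u ≡ f v → ∀ y → mergeLink f (u , v) y ≡ f y
    merge-redundant u~v y with f y ≟ f v
    ... | yes y~v = trans (merge-hit y y~v) (trans u~v (sym y~v))
    ... | no  y≁v = merge-miss y y≁v

  Singleton : (ℕ → ℕ) → ℕ → Set
  Singleton f w = ∀ y → f y ≡ f w → y ≡ w

  singleton-apart : ∀ {f w y} → Singleton f w → ¬ y ≡ w → ¬ f y ≡ f w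
  singleton-apart single y≢w y~w = y≢w (single _ y~w)

  merge-keeps : ∀ {f w} u v → ¬ v ≡ w → Singleton f w → mergeLink f (u , v) w ≡ f w
  merge-keeps {f} {w} u v v≢w single = merge-miss f u v w (λ w~v → v≢w (single v (sym w~v)))

  merge-singleton : ∀ {f w} u v → ¬ u ≡ w → ¬ v ≡ w → Singleton f w →
                    Singleton (mergeLink f (u , v)) w
  merge-singleton {f} {w} u v u≢w v≢w single y y~w with f y ≟ f v
  ... | yes y~v = ⊥-elim (singleton-apart single u≢w
                    (trans (sym (merge-hit f u v y y~v)) (trans y~w (merge-keeps u v v≢w single))))
  ... | no  y≁v = single y
                    (trans (sym (merge-miss f u v y y≁v)) (trans y~w (merge-keeps u v v≢w single)))

  fold-singletons : ∀ {f} (B : ℕ → Set) ls → All (Both (¬_ ∘ B)) ls →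
    (∀ {x} → B x → Singleton f x) → ∀ {x} → B x → Singleton (foldl mergeLink f ls) x
  fold-singletons B []             []                   singles = singles
  fold-singletons B ((u , v) ∷ ls) ((u∉B , v∉B) ∷ avoid) singles = fold-singletons B ls avoid
    (λ x∈B → merge-singleton u v (λ { refl → u∉B x∈B }) (λ { refl → v∉B x∈B }) (singles x∈B))

module Counting where

  open Splitting
  open Merging
  open import Data.Bool using (if_then_else_)
  open import Data.Nat using (suc; _+_; _≡ᵇ_; _<_)
  open import Data.Nat.Properties using (_≟_; +-suc; +-assoc; +-comm; +-identityʳ; +-cancelˡ-≡)
  open import Data.List using (List; []; _∷_; _++_; map; length; foldl; upTo; deduplicate)
  open import Data.List.Properties using (map-∘; map-cong; map-id; length-upTo)
  open import Data.List.Membership.Propositional using (_∈_; _∉_)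
  open import Data.List.Membership.Propositional.Properties
    using (∈-map⁺; ∈-map⁻; ∈-upTo⁺; deduplicate-∈⇔)
  open import Data.List.Membership.Propositional.Properties.WithK using (unique∧set⇒bag)
  open import Data.List.Relation.Unary.Unique.Propositional using (Unique)
  open import Data.List.Relation.Unary.Unique.Propositional.Properties using (upTo⁺)
  open import Data.List.Relation.Unary.Unique.DecPropositional.Properties _≟_ using (deduplicate-!)
  open import Data.List.Relation.Unary.All using (All; []; _∷_)
  open import Data.List.Relation.Unary.All.Properties using (¬Any⇒All¬)
  open import Data.List.Relation.Unary.AllPairs using (_∷_)
  open import Data.List.Relation.Unary.Any using (here; there)
  open import Data.List.Relation.Binary.BagAndSetEquality using (∼bag⇒↭)
  open import Data.List.Relation.Binary.Permutation.Propositional.Properties using (↭-length)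
  open import Data.Product using (_×_; _,_)
  open import Function using (id; _∘_)
  open import Function.Bundles using (mk⇔; Equivalence)
  open import Relation.Nullary using (¬_; yes; no)
  open import Relation.Binary.PropositionalEquality

  δ : ℕ → ℕ → ℕ
  δ p q = if p ≡ᵇ q then 1 else 0

  δ-same : ∀ {p q} → p ≡ q → δ p q ≡ 1
  δ-same p≡q rewrite ≡ᵇ-yes p≡q = refl

  δ-diff : ∀ {p q} → ¬ p ≡ q → δ p q ≡ 0
  δ-diff p≢q rewrite ≡ᵇ-no p≢q = refl

  redundant : (ℕ → ℕ) → List (ℕ × ℕ) → ℕ
  redundant f []             = 0
  redundant f ((u , v) ∷ ls) = δ (f u) (f v) + redundant (mergeLink f (u , v)) ls

  redundant-++ : ∀ f xs ys →
    redundant f (xs ++ ys) ≡ redundant f xs + redundant (foldl mergeLink f xs) ys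
  redundant-++ f []             ys = refl
  redundant-++ f ((u , v) ∷ xs) ys =
    trans (cong (δ (f u) (f v) +_) (redundant-++ (mergeLink f (u , v)) xs ys))
          (sym (+-assoc (δ (f u) (f v)) _ _))

  redundant-pair : ∀ f u v u′ v′ → redundant f ((u , v) ∷ (u′ , v′) ∷ []) ≡
                   δ (f u) (f v) + δ (mergeLink f (u , v) u′) (mergeLink f (u , v) v′)
  redundant-pair f u v u′ v′ = cong (δ (f u) (f v) +_) (+-identityʳ _)

  distinct : List ℕ → ℕ
  distinct ys = length (deduplicate _≟_ ys)

  ∈-dedup : ∀ {z ys} → z ∈ ys → z ∈ deduplicate _≟_ ys
  ∈-dedup = Equivalence.to (deduplicate-∈⇔ _≟_)

  dedup-∈ : ∀ {z ys} → z ∈ deduplicate _≟_ ys → z ∈ ys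
  dedup-∈ = Equivalence.from (deduplicate-∈⇔ _≟_)

  distinct-≡-length : ∀ {xs ys} → Unique xs →
    (∀ {z} → z ∈ xs → z ∈ ys) → (∀ {z} → z ∈ ys → z ∈ xs) → distinct ys ≡ length xs
  distinct-≡-length {xs} {ys} uxs to from =
    ↭-length (∼bag⇒↭ (unique∧set⇒bag (deduplicate-! ys) uxs
      (mk⇔ (from ∘ dedup-∈) (∈-dedup ∘ to))))

  -- Relabelling the value b as a (another value occurring in ys) removes
  -- exactly one distinct value: b ∷ (distinct entries of the relabelled list)
  -- enumerates the entries of ys without repetition.  Note that
  -- mergeLink f (u , v) is relabel (f u) (f v) ∘ f.
  relabel : ℕ → ℕ → ℕ → ℕ
  relabel a b z = if z ≡ᵇ b then a else z

  distinct-relabel : ∀ a b ys → a ∈ ys → b ∈ ys → ¬ a ≡ b →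
    suc (distinct (map (relabel a b) ys)) ≡ distinct ys
  distinct-relabel a b ys a∈ b∈ a≢b = sym (distinct-≡-length unique to from)
    where
    rest : List ℕ
    rest = deduplicate _≟_ (map (relabel a b) ys)

    relabel-≢b : ∀ z → ¬ relabel a b z ≡ b
    relabel-≢b z with z ≟ b
    ... | yes z≡b rewrite ≡ᵇ-yes z≡b = a≢b
    ... | no  z≢b rewrite ≡ᵇ-no z≢b  = z≢b

    b∉rest : b ∉ rest
    b∉rest b∈rest with ∈-map⁻ (relabel a b) (dedup-∈ b∈rest)
    ... | z , _ , b≡ = relabel-≢b z (sym b≡)

    unique : Unique (b ∷ rest)
    unique = ¬Any⇒All¬ rest b∉rest ∷ deduplicate-! _

    to : ∀ {z} → z ∈ b ∷ rest → z ∈ ys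
    to (here refl) = b∈
    to (there z∈) with ∈-map⁻ (relabel a b) (dedup-∈ z∈)
    ... | y , y∈ , refl with y ≟ b
    ...   | yes y≡b rewrite ≡ᵇ-yes y≡b = a∈
    ...   | no  y≢b rewrite ≡ᵇ-no y≢b  = y∈

    from : ∀ {z} → z ∈ ys → z ∈ b ∷ rest
    from {z} z∈ with z ≟ b
    ... | yes refl = here refl
    ... | no  z≢b  = there (∈-dedup (subst (_∈ map (relabel a b) ys)
                       (cong (if_then a else z) (≡ᵇ-no z≢b)) (∈-map⁺ (relabel a b) z∈)))

  Within : ℕ → List (ℕ × ℕ) → Set
  Within e = All (Both (_< e))

  merge-distinct : ∀ e f u v → u < e → v < e →
    suc (distinct (map (mergeLink f (u , v)) (upTo e))) ≡ distinct (map f (upTo e)) + δ (f u) (f v)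
  merge-distinct e f u v u<e v<e with f u ≟ f v
  ... | yes u~v = begin
    suc (distinct (map (mergeLink f (u , v)) (upTo e)))
      ≡⟨ cong (suc ∘ distinct) (map-cong (merge-redundant f u v u~v) (upTo e)) ⟩
    suc (distinct (map f (upTo e)))
      ≡⟨ +-comm 1 _ ⟩
    distinct (map f (upTo e)) + 1
      ≡⟨ cong (distinct (map f (upTo e)) +_) (sym (δ-same u~v)) ⟩
    distinct (map f (upTo e)) + δ (f u) (f v) ∎
    where open ≡-Reasoning
  ... | no u≁v = begin
    suc (distinct (map (mergeLink f (u , v)) (upTo e)))
      ≡⟨ cong (suc ∘ distinct) (map-∘ (upTo e)) ⟩
    suc (distinct (map (relabel (f u) (f v)) (map f (upTo e))))
      ≡⟨ distinct-relabel (f u) (f v) (map f (upTo e))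
           (∈-map⁺ f (∈-upTo⁺ u<e)) (∈-map⁺ f (∈-upTo⁺ v<e)) u≁v ⟩
    distinct (map f (upTo e))
      ≡⟨ sym (+-identityʳ _) ⟩
    distinct (map f (upTo e)) + 0
      ≡⟨ cong (distinct (map f (upTo e)) +_) (sym (δ-diff u≁v)) ⟩
    distinct (map f (upTo e)) + δ (f u) (f v) ∎
    where open ≡-Reasoning

  fold-distinct : ∀ e f ls → Within e ls →
    distinct (map (foldl mergeLink f ls) (upTo e)) + length ls ≡ distinct (map f (upTo e)) + redundant f ls
  fold-distinct e f []             []                = refl
  fold-distinct e f ((u , v) ∷ ls) ((u<e , v<e) ∷ ws) = begin
    distinct (map (foldl mergeLink g ls) (upTo e)) + suc (length ls)
      ≡⟨ +-suc _ _ ⟩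
    suc (distinct (map (foldl mergeLink g ls) (upTo e)) + length ls)
      ≡⟨ cong suc (fold-distinct e g ls ws) ⟩
    suc (distinct (map g (upTo e))) + redundant g ls
      ≡⟨ cong (_+ redundant g ls) (merge-distinct e f u v u<e v<e) ⟩
    distinct (map f (upTo e)) + δ (f u) (f v) + redundant g ls
      ≡⟨ +-assoc (distinct (map f (upTo e))) _ _ ⟩
    distinct (map f (upTo e)) + redundant f ((u , v) ∷ ls) ∎
    where
    open ≡-Reasoning
    g : ℕ → ℕ
    g = mergeLink f (u , v)

  components≡redundant : ∀ e ls → Within e ls → length ls ≡ e → components e ls ≡ redundant id ls
  components≡redundant e ls ws len = +-cancelˡ-≡ e _ _ (begin
    e + components e ls                               ≡⟨ +-comm e _ ⟩
    components e ls + e                               ≡⟨ cong (components e ls +_) (sym len) ⟩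
    components e ls + length ls                       ≡⟨ fold-distinct e id ls ws ⟩
    distinct (map id (upTo e)) + redundant id ls      ≡⟨ cong (_+ redundant id ls) distinct-id ⟩
    e + redundant id ls                               ∎)
    where
    open ≡-Reasoning
    distinct-id : distinct (map id (upTo e)) ≡ e
    distinct-id = trans (cong distinct (map-id (upTo e)))
                        (trans (distinct-≡-length (upTo⁺ e) id id) (length-upTo e))

module Renaming where

  open Merging
  open Counting
  open import Data.Bool using (true; false)
  open import Data.Nat using (suc; _+_; _<_)
  open import Data.Nat.Properties using (_≟_; <-cmp; <⇒≢; <-trans; n<1+n; m<1+n⇒m<n∨m≡n)
  open import Data.List using ([]; _∷_; map; foldl)
  open import Data.List.Relation.Unary.All using ([]; _∷_)
  open import Data.Product using (_×_; _,_)
  open import Data.Sum using (inj₁; inj₂)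
  open import Data.Empty using (⊥-elim)
  open import Function using (_∘_)
  open import Relation.Binary.Definitions using (tri<; tri≈; tri>)
  open import Relation.Nullary using (yes; no)
  open import Relation.Binary.PropositionalEquality

  rename : (ℕ → ℕ) → ℕ × ℕ → ℕ × ℕ
  rename ρ (u , v) = (ρ u , ρ v)

  split-rename : ∀ ρ a b c d s →
    split (ρ a , ρ b , ρ c , ρ d) s ≡ map (rename ρ) (split (a , b , c , d) s)
  split-rename ρ a b c d true  = refl
  split-rename ρ a b c d false = refl

  redundant-rename : ∀ f ρ ls → redundant f (map (rename ρ) ls) ≡ redundant (f ∘ ρ) ls
  redundant-rename f ρ []             = refl
  redundant-rename f ρ ((u , v) ∷ ls) =
    cong (δ (f (ρ u)) (f (ρ v)) +_) (redundant-rename (mergeLink f (ρ u , ρ v)) ρ ls)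

  fold-rename : ∀ f ρ ls w → foldl mergeLink f (map (rename ρ) ls) (ρ w) ≡ foldl mergeLink (f ∘ ρ) ls w
  fold-rename f ρ []             w = refl
  fold-rename f ρ ((u , v) ∷ ls) w = fold-rename (mergeLink f (ρ u , ρ v)) ρ ls w

  Refines : ℕ → (ℕ → ℕ) → (ℕ → ℕ) → Set
  Refines e f g = ∀ {x y} → x < e → y < e → f x ≡ f y → g x ≡ g y

  merge-class-of-u : ∀ g u v y → g y ≡ g u → mergeLink g (u , v) y ≡ g u
  merge-class-of-u g u v y y~u with g y ≟ g v
  ... | yes y~v = merge-hit g u v y y~v
  ... | no  y≁v = trans (merge-miss g u v y y≁v) y~u

  merge-refines : ∀ {e f g u v} → u < e → v < e → Refines e f g →
                  Refines e (mergeLink f (u , v)) (mergeLink g (u , v))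
  merge-refines {e} {f} {g} {u} {v} u<e v<e r {x} {y} x<e y<e x~y with f x ≟ f v | f y ≟ f v
  ... | yes x~v | yes y~v = trans (merge-hit g u v x (r x<e v<e x~v)) (sym (merge-hit g u v y (r y<e v<e y~v)))
  ... | yes x~v | no  y≁v = trans (merge-hit g u v x (r x<e v<e x~v)) (sym (merge-class-of-u g u v y
          (r y<e u<e (trans (sym (merge-miss f u v y y≁v)) (trans (sym x~y) (merge-hit f u v x x~v))))))
  ... | no  x≁v | yes y~v = trans (merge-class-of-u g u v x
          (r x<e u<e (trans (sym (merge-miss f u v x x≁v)) (trans x~y (merge-hit f u v y y~v)))))
          (sym (merge-hit g u v y (r y<e v<e y~v)))
  ... | no  x≁v | no  y≁v = merge-cong g u v x y
          (r x<e y<e (trans (sym (merge-miss f u v x x≁v)) (trans x~y (merge-miss f u v y y≁v))))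

  fold-refines : ∀ {e f g} ls → Within e ls → Refines e f g →
                 Refines e (foldl mergeLink f ls) (foldl mergeLink g ls)
  fold-refines []             []                 r = r
  fold-refines ((u , v) ∷ ls) ((u<e , v<e) ∷ ws) r = fold-refines ls ws (merge-refines u<e v<e r)

  redundant-same : ∀ {e} f g ls → Within e ls → Refines e f g → Refines e g f →
                   redundant f ls ≡ redundant g ls
  redundant-same f g []             []                 fg gf = refl
  redundant-same f g ((u , v) ∷ ls) ((u<e , v<e) ∷ ws) fg gf with f u ≟ f v
  ... | yes u~v = cong₂ _+_ (trans (δ-same u~v) (sym (δ-same (fg u<e v<e u~v))))
                    (redundant-same _ _ ls ws (merge-refines u<e v<e fg) (merge-refines u<e v<e gf))
  ... | no  u≁v = cong₂ _+_ (trans (δ-diff u≁v) (sym (δ-diff (u≁v ∘ gf u<e v<e))))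
                    (redundant-same _ _ ls ws (merge-refines u<e v<e fg) (merge-refines u<e v<e gf))

  module _ {e} (ρ : ℕ → ℕ) (step : ∀ x → suc x < e → ρ x < ρ (suc x)) where

    increasing : ∀ {a b} → a < b → b < e → ρ a < ρ b
    increasing {a} {suc b} a<b+1 b+1<e with m<1+n⇒m<n∨m≡n a<b+1
    ... | inj₁ a<b  = <-trans (increasing a<b (<-trans (n<1+n b) b+1<e)) (step b b+1<e)
    ... | inj₂ refl = step a b+1<e

    increasing-injective : ∀ {x y} → x < e → y < e → ρ x ≡ ρ y → x ≡ y
    increasing-injective {x} {y} x<e y<e ρx≡ρy with <-cmp x y
    ... | tri< x<y _ _ = ⊥-elim (<⇒≢ (increasing x<y y<e) ρx≡ρy)
    ... | tri≈ _ x≡y _ = x≡y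
    ... | tri> _ _ y<x = ⊥-elim (<⇒≢ (increasing y<x x<e) (sym ρx≡ρy))

-- Processing the region from left to right,
-- the already processed links connect the current left ends a (upper) and
-- b (lower) and the far right ends c (upper) and d (lower) in one of two
-- patterns.  The next crossing has ends a, b on its left and fresh vertices
-- a', b' on its right; its Bool chooses between splitting horizontally
-- (links b–b', a'–a) and vertically (links b–a, b'–a').
module TwistCrossing where

  open Merging
  open Counting
  open import Data.Bool using (Bool; true; false)
  open import Data.Nat using (_+_)
  open import Data.Nat.Properties using (+-identityʳ)
  open import Data.List using (List; []; _∷_; foldl)
  open import Data.Product using (_×_; _,_; proj₁; proj₂)
  open import Function using (_∘_)
  open import Relation.Nullary using (¬_)
  open import Relation.Binary.PropositionalEquality

  data Pattern : Set where
    through capped : Pattern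

  Holds : Pattern → (ℕ → ℕ) → (a b c d : ℕ) → Set
  Holds through f a b c d = f a ≡ f c × f b ≡ f d × ¬ f a ≡ f b
  Holds capped  f a b c d = f a ≡ f b × f c ≡ f d × ¬ f a ≡ f c

  -- The pattern after an inner crossing, and its number of redundant links:
  -- a vertical split joins a to b, which closes a curve exactly when a ~ b.
  next : Pattern → Bool → Pattern
  next P true  = P
  next P false = capped

  gain : Pattern → Bool → ℕ
  gain P       true  = 0
  gain through false = 0
  gain capped  false = 1

  -- The last crossing, whose right ends are c and d themselves.
  closing : Pattern → Bool → ℕ
  closing through true  = 2
  closing through false = 1
  closing capped  true  = 1
  closing capped  false = 2

  -- Curves closed inside a twist region whose crossings are split according
  -- to s ∷ t, entered in pattern P.
  twistCurves : Pattern → Bool → List Bool → ℕ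
  twistCurves P s []       = closing P s
  twistCurves P s (s′ ∷ t) = gain P s + twistCurves (next P s) s′ t

  closing-step : ∀ f a b c d P s → Holds P f a b c d → redundant f (split (b , d , c , a) s) ≡ closing P s
  closing-step f a b c d through true  (a~c , b~d , a≁b) =
    trans (redundant-pair f b d c a) (cong₂ _+_ (δ-same b~d) (δ-same (merge-cong f b d c a (sym a~c))))
  closing-step f a b c d through false (a~c , b~d , a≁b) =
    trans (redundant-pair f b a d c) (cong₂ _+_ (δ-diff (a≁b ∘ sym)) (δ-same d~c))
    where
    d~c : mergeLink f (b , a) d ≡ mergeLink f (b , a) c
    d~c = trans (merge-miss f b a d (λ d~a → a≁b (trans (sym d~a) (sym b~d))))
                (trans (sym b~d) (sym (merge-hit f b a c (sym a~c))))
  closing-step f a b c d capped  true  (a~b , c~d , a≁c) =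
    trans (redundant-pair f b d c a) (cong₂ _+_ (δ-diff b≁d) (δ-same c~a))
    where
    b≁d : ¬ f b ≡ f d
    b≁d b~d = a≁c (trans a~b (trans b~d (sym c~d)))
    c~a : mergeLink f (b , d) c ≡ mergeLink f (b , d) a
    c~a = trans (merge-hit f b d c c~d)
                (trans (sym a~b) (sym (merge-miss f b d a (λ a~d → a≁c (trans a~d (sym c~d))))))
  closing-step f a b c d capped  false (a~b , c~d , a≁c) =
    trans (redundant-pair f b a d c) (cong₂ _+_ (δ-same (sym a~b)) (δ-same (merge-cong f b a d c (sym c~d))))

  module InnerCrossing (f : ℕ → ℕ) (B : ℕ → Set) (fresh : ∀ {x} → B x → Singleton f x)
    {a b a′ b′ c d : ℕ} (a′∈B : B a′) (b′∈B : B b′) (a′≢b′ : ¬ a′ ≡ b′)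
    (a∉B : ¬ B a) (b∉B : ¬ B b) (c∉B : ¬ B c) (d∉B : ¬ B d) where

    private
      old≢new : ∀ {x y} → ¬ B x → B y → ¬ x ≡ y
      old≢new x∉B y∈B refl = x∉B y∈B

    module Horizontal where
      f₁ f₂ : ℕ → ℕ
      f₁ = mergeLink f (b , b′)
      f₂ = mergeLink f₁ (a′ , a)

      f₁-keeps : ∀ {y} → ¬ y ≡ b′ → f₁ y ≡ f y
      f₁-keeps y≢b′ = merge-miss f b b′ _ (singleton-apart (fresh b′∈B) y≢b′)

      a′-single : Singleton f₁ a′
      a′-single = merge-singleton b b′ (old≢new b∉B a′∈B) (a′≢b′ ∘ sym) (fresh a′∈B)

      a≁a′ : ¬ f₁ a ≡ f₁ a′
      a≁a′ = singleton-apart a′-single (old≢new a∉B a′∈B)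

      f₂-a′ : f₂ a′ ≡ f₁ a′
      f₂-a′ = merge-miss f₁ a′ a a′ (a≁a′ ∘ sym)

      redundant-h : redundant f (split (b , b′ , a′ , a) true) ≡ 0
      redundant-h = trans (redundant-pair f b b′ a′ a)
        (cong₂ _+_ (δ-diff (singleton-apart (fresh b′∈B) (old≢new b∉B b′∈B))) (δ-diff (a≁a′ ∘ sym)))

      f₁-b′ : f₁ b′ ≡ f b
      f₁-b′ = merge-hit f b b′ b′ refl

      f₁-a : f₁ a ≡ f a
      f₁-a = f₁-keeps (old≢new a∉B b′∈B)
      f₁-c : f₁ c ≡ f c
      f₁-c = f₁-keeps (old≢new c∉B b′∈B)
      f₁-d : f₁ d ≡ f d
      f₁-d = f₁-keeps (old≢new d∉B b′∈B)

      step : ∀ P → Holds P f a b c d → Holds P f₂ a′ b′ c d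
      step through (a~c , b~d , a≁b) = a′~c , b′~d , a′≁b′
        where
        a′~c : f₂ a′ ≡ f₂ c
        a′~c = trans f₂-a′ (sym (merge-hit f₁ a′ a c (trans f₁-c (trans (sym a~c) (sym f₁-a)))))
        b′~d : f₂ b′ ≡ f₂ d
        b′~d = merge-cong f₁ a′ a b′ d (trans f₁-b′ (trans b~d (sym f₁-d)))
        f₂-b′ : f₂ b′ ≡ f₁ b′
        f₂-b′ = merge-miss f₁ a′ a b′ (λ b′~a → a≁b (sym (trans (sym f₁-b′) (trans b′~a f₁-a))))
        a′≁b′ : ¬ f₂ a′ ≡ f₂ b′
        a′≁b′ a′~b′ = a′≢b′ (sym (a′-single b′ (trans (sym f₂-b′) (trans (sym a′~b′) f₂-a′))))
      step capped (a~b , c~d , a≁c) = a′~b′ , c~d′ , a′≁c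
        where
        a′~b′ : f₂ a′ ≡ f₂ b′
        a′~b′ = trans f₂-a′ (sym (merge-hit f₁ a′ a b′ (trans f₁-b′ (trans (sym a~b) (sym f₁-a)))))
        c~d′ : f₂ c ≡ f₂ d
        c~d′ = merge-cong f₁ a′ a c d (trans f₁-c (trans c~d (sym f₁-d)))
        f₂-c : f₂ c ≡ f₁ c
        f₂-c = merge-miss f₁ a′ a c (λ c~a → a≁c (sym (trans (sym f₁-c) (trans c~a f₁-a))))
        a′≁c : ¬ f₂ a′ ≡ f₂ c
        a′≁c a′~c = old≢new c∉B a′∈B (a′-single c (trans (sym f₂-c) (trans (sym a′~c) f₂-a′)))

    module Vertical where
      f₁ f₂ : ℕ → ℕ
      f₁ = mergeLink f (b , a)
      f₂ = mergeLink f₁ (b′ , a′)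

      a′-single : Singleton f₁ a′
      a′-single = merge-singleton b a (old≢new b∉B a′∈B) (old≢new a∉B a′∈B) (fresh a′∈B)

      b′-single : Singleton f₁ b′
      b′-single = merge-singleton b a (old≢new b∉B b′∈B) (old≢new a∉B b′∈B) (fresh b′∈B)

      f₂-a′ : f₂ a′ ≡ f₁ b′
      f₂-a′ = merge-hit f₁ b′ a′ a′ refl

      f₂-keeps : ∀ {y} → ¬ y ≡ a′ → f₂ y ≡ f₁ y
      f₂-keeps y≢a′ = merge-miss f₁ b′ a′ _ (singleton-apart a′-single y≢a′)

      redundant-v : redundant f (split (b , b′ , a′ , a) false) ≡ δ (f b) (f a)
      redundant-v = trans (redundant-pair f b a b′ a′)
        (trans (cong (δ (f b) (f a) +_) (δ-diff (singleton-apart a′-single (a′≢b′ ∘ sym))))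
               (+-identityʳ _))

      left-link : ∀ P → Holds P f a b c d → δ (f b) (f a) ≡ gain P false × f₁ c ≡ f₁ d
      left-link through (a~c , b~d , a≁b) =
        δ-diff (a≁b ∘ sym) ,
        trans (merge-hit f b a c (sym a~c))
              (trans b~d (sym (merge-miss f b a d (λ d~a → a≁b (trans (sym d~a) (sym b~d))))))
      left-link capped (a~b , c~d , a≁c) = δ-same (sym a~b) , merge-cong f b a c d c~d

      step : f₁ c ≡ f₁ d → Holds capped f₂ a′ b′ c d
      step c~d = a′~b′ , c~d′ , a′≁c
        where
        a′~b′ : f₂ a′ ≡ f₂ b′
        a′~b′ = trans f₂-a′ (sym (f₂-keeps (a′≢b′ ∘ sym)))
        c~d′ : f₂ c ≡ f₂ d
        c~d′ = trans (f₂-keeps (old≢new c∉B a′∈B)) (trans c~d (sym (f₂-keeps (old≢new d∉B a′∈B))))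
        a′≁c : ¬ f₂ a′ ≡ f₂ c
        a′≁c a′~c = old≢new c∉B b′∈B
          (b′-single c (trans (sym (f₂-keeps (old≢new c∉B a′∈B))) (trans (sym a′~c) f₂-a′)))

    inner-step : ∀ P s → Holds P f a b c d →
      redundant f (split (b , b′ , a′ , a) s) ≡ gain P s ×
      Holds (next P s) (foldl mergeLink f (split (b , b′ , a′ , a) s)) a′ b′ c d
    inner-step P true  holds = Horizontal.redundant-h , Horizontal.step P holds
    inner-step P false holds =
      trans Vertical.redundant-v (proj₁ left) , Vertical.step (proj₂ left)
      where
      left : δ (f b) (f a) ≡ gain P false × Vertical.f₁ c ≡ Vertical.f₁ d
      left = Vertical.left-link P holds

module TwistRegion (m : ℕ) where

  open Splitting
  open Merging
  open Counting
  open TwistCrossing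
  open import Data.Bool using (Bool)
  open import Data.Nat using (suc; _+_; _<_; _≤_; s≤s; z≤n)
  open import Data.Nat.Properties
  open import Data.List using (List; []; _∷_; _++_; length; foldl)
  open import Data.List.Properties using (++-identityʳ)
  open import Data.List.Relation.Unary.All using (All; []; _∷_)
  open import Data.Product using (_×_; _,_; proj₁; proj₂)
  open import Data.Sum using (_⊎_; inj₁; inj₂)
  open import Function using (_∘_)
  open import Relation.Nullary using (¬_)
  open import Relation.Binary.PropositionalEquality

  n : ℕ
  n = suc m
  open TwistLabels n public

  Beyond : ℕ → ℕ → Set
  Beyond i x = (i < x × x < n) ⊎ (L i < x × x < L n)

  Fresh : (ℕ → ℕ) → ℕ → Set
  Fresh f i = ∀ {x} → Beyond i x → Singleton f x

  upper-not-beyond : ∀ {i x} → x ≤ i → ¬ Beyond i x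
  upper-not-beyond x≤i (inj₁ (i<x , _)) = <⇒≱ i<x x≤i
  upper-not-beyond {i} x≤i (inj₂ (Li<x , _)) = <⇒≱ Li<x (≤-trans x≤i (m≤n+m i (suc n)))

  lower-not-beyond : ∀ {i x} → n ≤ x → x ≤ L i → ¬ Beyond i x
  lower-not-beyond n≤x _ (inj₁ (_ , x<n)) = <⇒≱ x<n n≤x
  lower-not-beyond _ x≤Li (inj₂ (Li<x , _)) = <⇒≱ Li<x x≤Li

  outer-not-beyond : ∀ {i x} → L n ≤ x → ¬ Beyond i x
  outer-not-beyond Ln≤x (inj₁ (_ , x<n)) = <⇒≱ x<n (≤-trans (m≤n+m n (suc n)) Ln≤x)
  outer-not-beyond Ln≤x (inj₂ (_ , x<Ln)) = <⇒≱ x<Ln Ln≤x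

  beyond-shrinks : ∀ {i x} → Beyond (suc i) x → Beyond i x
  beyond-shrinks (inj₁ (i+1<x , x<n)) = inj₁ (<-trans (n<1+n _) i+1<x , x<n)
  beyond-shrinks (inj₂ (Li+1<x , x<Ln)) = inj₂ (<-trans (+-monoʳ-< (suc n) (n<1+n _)) Li+1<x , x<Ln)

  L-mono : ∀ {i j} → i ≤ j → L i ≤ L j
  L-mono = +-monoʳ-≤ (suc n)

  n≤L : ∀ i → n ≤ L i
  n≤L i = ≤-trans (n≤1+n n) (m≤m+n (suc n) i)

  crossing : ℕ → Crossing
  crossing i = (L i , L (suc i) , U (suc i) , U i)

  crossingsFrom : ℕ → ℕ → List Crossing
  crossingsFrom i 0       = []
  crossingsFrom i (suc r) = crossing i ∷ crossingsFrom (suc i) r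

  crossingsFrom-snoc : ∀ i r → crossingsFrom i (suc r) ≡ crossingsFrom i r ++ crossing (i + r) ∷ []
  crossingsFrom-snoc i 0       rewrite +-identityʳ i = refl
  crossingsFrom-snoc i (suc r) rewrite +-suc i r = cong (crossing i ∷_) (crossingsFrom-snoc (suc i) r)

  twistCrossings≡ : ∀ k → twistCrossings n k ≡ crossingsFrom 0 k
  twistCrossings≡ 0       = refl
  twistCrossings≡ (suc k) = trans (cong (_++ crossing k ∷ []) (twistCrossings≡ k)) (sym (crossingsFrom-snoc 0 k))

  crossingsFrom-length : ∀ i r → length (crossingsFrom i r) ≡ r
  crossingsFrom-length i 0       = refl
  crossingsFrom-length i (suc r) = cong suc (crossingsFrom-length (suc i) r)

  crossingsFrom-ends : ∀ i r → i + r ≤ n → All (Ends (_≤ L n)) (crossingsFrom i r)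
  crossingsFrom-ends i 0       _ = []
  crossingsFrom-ends i (suc r) i+r+1≤n =
    (L-mono i≤n , L-mono i+1≤n , ≤-trans i+1≤n (n≤L n) , ≤-trans i≤n (n≤L n))
    ∷ crossingsFrom-ends (suc i) r (subst (_≤ n) (+-suc i r) i+r+1≤n)
    where
    i+1≤n : suc i ≤ n
    i+1≤n = ≤-trans (s≤s (m≤m+n i r)) (subst (_≤ n) (+-suc i r) i+r+1≤n)
    i≤n : i ≤ n
    i≤n = ≤-trans (n≤1+n i) i+1≤n

  links : ℕ → List Bool → List (ℕ × ℕ)
  links i t = stateLinks (crossingsFrom i (length t)) t

  inner-crossing : ∀ {i f} P s → suc i < n → Fresh f i → Holds P f (U i) (L i) (U n) (L n) →
    redundant f (split (crossing i) s) ≡ gain P s ×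
    Holds (next P s) (foldl mergeLink f (split (crossing i) s)) (U (suc i)) (L (suc i)) (U n) (L n) ×
    Fresh (foldl mergeLink f (split (crossing i) s)) (suc i)
  inner-crossing {i} {f} P s i+1<n fresh holds = proj₁ step , proj₂ step , fresh′
    where
    Ui+1∈ : Beyond i (U (suc i))
    Ui+1∈ = inj₁ (n<1+n i , i+1<n)
    Li+1∈ : Beyond i (L (suc i))
    Li+1∈ = inj₂ (+-monoʳ-< (suc n) (n<1+n i) , +-monoʳ-< (suc n) i+1<n)
    step : redundant f (split (crossing i) s) ≡ gain P s ×
           Holds (next P s) (foldl mergeLink f (split (crossing i) s)) (U (suc i)) (L (suc i)) (U n) (L n)
    step = InnerCrossing.inner-step f (Beyond i) fresh Ui+1∈ Li+1∈ (<⇒≢ (<-≤-trans i+1<n (n≤L (suc i))))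
             (upper-not-beyond ≤-refl) (lower-not-beyond (n≤L i) ≤-refl)
             (lower-not-beyond ≤-refl (n≤L i)) (outer-not-beyond ≤-refl) P s holds
    fresh′ : Fresh (foldl mergeLink f (split (crossing i) s)) (suc i)
    fresh′ = fold-singletons (Beyond (suc i)) (split (crossing i) s)
      (split-all (crossing i) s ( lower-not-beyond (n≤L i) (L-mono (n≤1+n i))
                                , lower-not-beyond (n≤L (suc i)) ≤-refl
                                , upper-not-beyond ≤-refl
                                , upper-not-beyond (n≤1+n i)))
      (fresh ∘ beyond-shrinks)

  last-crossing : ∀ {i} → suc i ≡ n → crossing i ≡ (L i , L n , U n , U i)
  last-crossing {i} i+1≡n = cong (λ j → (L i , L j , U j , U i)) i+1≡n

  twist-redundant : ∀ i f P s t → i + suc (length t) ≡ n → Fresh f i →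
    Holds P f (U i) (L i) (U n) (L n) → redundant f (links i (s ∷ t)) ≡ twistCurves P s t
  twist-redundant i f P s [] i+1≡n fresh holds = begin
    redundant f (split (crossing i) s ++ [])       ≡⟨ cong (redundant f) (++-identityʳ (split (crossing i) s)) ⟩
    redundant f (split (crossing i) s)             ≡⟨ cong (λ cr → redundant f (split cr s))
                                                        (last-crossing (trans (+-comm 1 i) i+1≡n)) ⟩
    redundant f (split (L i , L n , U n , U i) s)  ≡⟨ closing-step f (U i) (L i) (U n) (L n) P s holds ⟩
    closing P s                                    ∎
    where open ≡-Reasoning
  twist-redundant i f P s (s′ ∷ t) i+2+k≡n fresh holds
    with inner-crossing P s i+1<n fresh holds
    where
    i+1<n : suc i < n
    i+1<n = subst (suc i <_) (trans (sym (+-suc i (suc (length t)))) i+2+k≡n)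
                  (s≤s (m<m+n i (s≤s z≤n)))
  ... | gained , holds′ , fresh′ = begin
    redundant f (split (crossing i) s ++ links (suc i) (s′ ∷ t))
      ≡⟨ redundant-++ f (split (crossing i) s) _ ⟩
    redundant f (split (crossing i) s) + redundant f′ (links (suc i) (s′ ∷ t))
      ≡⟨ cong₂ _+_ gained (twist-redundant (suc i) f′ (next P s) s′ t
                             (trans (sym (+-suc i _)) i+2+k≡n) fresh′ holds′) ⟩
    gain P s + twistCurves (next P s) s′ t ∎
    where
    open ≡-Reasoning
    f′ : ℕ → ℕ
    f′ = foldl mergeLink f (split (crossing i) s)

-- They involve
-- only the six edges U 0, U n, L 0, L n, E, F, so the computation is
-- transported from the model clasp on the vertices 0 … 5, where it is done
-- by evaluation.
module Clasp (m : ℕ) where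

  open Splitting
  open Merging
  open Counting
  open Renaming
  open TwistCrossing
  open TwistRegion m
  open import Data.Bool using (Bool; true; false; T)
  open import Data.Nat using (suc; _<_; _<ᵇ_; s≤s; z≤n)
  open import Data.Nat.Properties
  open import Data.List using (List; _++_; map; foldl)
  open import Data.List.Properties using (map-++)
  open import Data.List.Relation.Unary.All.Properties using (++⁺)
  open import Data.Product using (_×_; _,_)
  open import Function using (id)
  open import Relation.Nullary using (¬_)
  open import Relation.Binary.PropositionalEquality

  q p : Crossing
  q = (U 0 , U n , E , F)
  p = (E , L n , L 0 , F)

  claspLinks : Bool → Bool → List (ℕ × ℕ)
  claspLinks s₁ s₂ = split q s₁ ++ split p s₂

  modelLinks : Bool → Bool → List (ℕ × ℕ)
  modelLinks s₁ s₂ = split (0 , 1 , 4 , 5) s₁ ++ split (4 , 3 , 2 , 5) s₂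

  ρ : ℕ → ℕ
  ρ 0 = U 0
  ρ 1 = U n
  ρ 2 = L 0
  ρ 3 = L n
  ρ 4 = E
  ρ 5 = F
  ρ _ = 0

  claspLinks-model : ∀ s₁ s₂ → claspLinks s₁ s₂ ≡ map (rename ρ) (modelLinks s₁ s₂)
  claspLinks-model s₁ s₂ = trans (cong₂ _++_ (split-rename ρ 0 1 4 5 s₁) (split-rename ρ 4 3 2 5 s₂))
                                 (sym (map-++ (rename ρ) (split (0 , 1 , 4 , 5) s₁) _))

  ρ-step : ∀ x → suc x < 6 → ρ x < ρ (suc x)
  ρ-step 0 _ = s≤s z≤n
  ρ-step 1 _ = s≤s (m≤m+n n 0)
  ρ-step 2 _ = +-monoʳ-< (suc n) (s≤s z≤n)
  ρ-step 3 _ = ≤-refl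
  ρ-step 4 _ = ≤-refl
  ρ-step (suc (suc (suc (suc (suc _))))) (s≤s (s≤s (s≤s (s≤s (s≤s (s≤s ()))))))

  ρ-refines-id : Refines 6 ρ id
  ρ-refines-id = increasing-injective ρ ρ-step

  id-refines-ρ : Refines 6 id ρ
  id-refines-ρ _ _ = cong ρ

  model-within : ∀ s₁ s₂ → Within 6 (modelLinks s₁ s₂)
  model-within s₁ s₂ = ++⁺ (split-all (0 , 1 , 4 , 5) s₁ (<ᵇ⇒< 0 6 _ , <ᵇ⇒< 1 6 _ , <ᵇ⇒< 4 6 _ , <ᵇ⇒< 5 6 _))
                           (split-all (4 , 3 , 2 , 5) s₂ (<ᵇ⇒< 4 6 _ , <ᵇ⇒< 3 6 _ , <ᵇ⇒< 2 6 _ , <ᵇ⇒< 5 6 _))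

  claspLabels modelLabels : Bool → Bool → ℕ → ℕ
  claspLabels s₁ s₂ = foldl mergeLink id (claspLinks s₁ s₂)
  modelLabels s₁ s₂ = foldl mergeLink id (modelLinks s₁ s₂)

  module Transfer (s₁ s₂ : Bool) where

    pulled-back : ∀ x → claspLabels s₁ s₂ (ρ x) ≡ foldl mergeLink ρ (modelLinks s₁ s₂) x
    pulled-back x = trans (cong (λ ls → foldl mergeLink id ls (ρ x)) (claspLinks-model s₁ s₂))
                          (fold-rename id ρ (modelLinks s₁ s₂) x)

    joined : ∀ x y → {T (x <ᵇ 6)} → {T (y <ᵇ 6)} →
             modelLabels s₁ s₂ x ≡ modelLabels s₁ s₂ y → claspLabels s₁ s₂ (ρ x) ≡ claspLabels s₁ s₂ (ρ y)
    joined x y {x<6} {y<6} x~y = trans (pulled-back x) (trans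
      (fold-refines (modelLinks s₁ s₂) (model-within s₁ s₂) id-refines-ρ (<ᵇ⇒< x 6 x<6) (<ᵇ⇒< y 6 y<6) x~y)
      (sym (pulled-back y)))

    apart : ∀ x y → {T (x <ᵇ 6)} → {T (y <ᵇ 6)} →
            ¬ modelLabels s₁ s₂ x ≡ modelLabels s₁ s₂ y → ¬ claspLabels s₁ s₂ (ρ x) ≡ claspLabels s₁ s₂ (ρ y)
    apart x y {x<6} {y<6} x≁y ρx~ρy = x≁y
      (fold-refines (modelLinks s₁ s₂) (model-within s₁ s₂) ρ-refines-id (<ᵇ⇒< x 6 x<6) (<ᵇ⇒< y 6 y<6)
        (trans (sym (pulled-back x)) (trans ρx~ρy (pulled-back y))))

  claspPattern : Bool → Bool → Pattern
  claspPattern true  true  = through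
  claspPattern true  false = through
  claspPattern false true  = capped
  claspPattern false false = through

  claspRedundant : Bool → Bool → ℕ
  claspRedundant true  true  = 0
  claspRedundant true  false = 1
  claspRedundant false true  = 0
  claspRedundant false false = 0

  clasp-redundant : ∀ s₁ s₂ → redundant id (claspLinks s₁ s₂) ≡ claspRedundant s₁ s₂
  clasp-redundant s₁ s₂ = begin
    redundant id (claspLinks s₁ s₂)                  ≡⟨ cong (redundant id) (claspLinks-model s₁ s₂) ⟩
    redundant id (map (rename ρ) (modelLinks s₁ s₂)) ≡⟨ redundant-rename id ρ (modelLinks s₁ s₂) ⟩
    redundant ρ (modelLinks s₁ s₂)                   ≡⟨ redundant-same ρ id (modelLinks s₁ s₂) (model-within s₁ s₂)
                                                          ρ-refines-id id-refines-ρ ⟩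
    redundant id (modelLinks s₁ s₂)                  ≡⟨ model-redundant s₁ s₂ ⟩
    claspRedundant s₁ s₂                             ∎
    where
    open ≡-Reasoning
    model-redundant : ∀ s₁ s₂ → redundant id (modelLinks s₁ s₂) ≡ claspRedundant s₁ s₂
    model-redundant true  true  = refl
    model-redundant true  false = refl
    model-redundant false true  = refl
    model-redundant false false = refl

  clasp-pattern : ∀ s₁ s₂ → Holds (claspPattern s₁ s₂) (claspLabels s₁ s₂) (U 0) (L 0) (U n) (L n)
  clasp-pattern true  true  = joined 0 1 refl , joined 2 3 refl , apart 0 2 (λ ())
    where open Transfer true true
  clasp-pattern true  false = joined 0 1 refl , joined 2 3 refl , apart 0 2 (λ ())
    where open Transfer true false
  clasp-pattern false true  = joined 0 2 refl , joined 1 3 refl , apart 0 1 (λ ())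
    where open Transfer false true
  clasp-pattern false false = joined 0 1 refl , joined 2 3 refl , apart 0 2 (λ ())
    where open Transfer false false

  clasp-fresh : ∀ s₁ s₂ → Fresh (claspLabels s₁ s₂) 0
  clasp-fresh s₁ s₂ = fold-singletons (Beyond 0) (claspLinks s₁ s₂)
    (++⁺ (split-all q s₁ (U0∉ , Un∉ , E∉ , F∉)) (split-all p s₂ (E∉ , Ln∉ , L0∉ , F∉)))
    (λ _ _ y~x → y~x)
    where
    U0∉ : ¬ Beyond 0 (U 0)
    U0∉ = upper-not-beyond z≤n
    Un∉ : ¬ Beyond 0 (U n)
    Un∉ = lower-not-beyond ≤-refl (n≤L 0)
    L0∉ : ¬ Beyond 0 (L 0)
    L0∉ = lower-not-beyond (n≤L 0) ≤-refl
    Ln∉ : ¬ Beyond 0 (L n)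
    Ln∉ = outer-not-beyond ≤-refl
    E∉ : ¬ Beyond 0 E
    E∉ = outer-not-beyond (n≤1+n (L n))
    F∉ : ¬ Beyond 0 F
    F∉ = outer-not-beyond (≤-trans (n≤1+n (L n)) (n≤1+n (suc (L n))))

module TwistKnotStates (m : ℕ) where

  open Splitting
  open Counting
  open TwistCrossing
  open TwistRegion m
  open Clasp m
  open import Data.Bool using (Bool)
  open import Data.Nat using (suc; _+_; _<_; _≤_; s≤s; z≤n)
  open import Data.Nat.Properties
  open import Data.List using (List; _∷_; _++_; length)
  open import Data.List.Properties using (++-assoc)
  open import Data.List.Relation.Unary.All using (All; _∷_)
  import Data.List.Relation.Unary.All as All
  open import Data.Product using (_×_; _,_)
  open import Function using (id; _∘_)
  open import Relation.Binary.PropositionalEquality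

  crossings-ends : All (Ends (_< edges (τ n))) (crossings (τ n))
  crossings-ends = All.map (ends-map {P = _≤ F} s≤s)
    ( (z≤n , Ln≤F (n≤L n) , E≤F , ≤-refl)
    ∷ (E≤F , Ln≤F ≤-refl , Ln≤F (L-mono z≤n) , ≤-refl)
    ∷ subst (All (Ends (_≤ F))) (sym (twistCrossings≡ n))
        (All.map (ends-map {P = _≤ L n} Ln≤F) (crossingsFrom-ends 0 n ≤-refl)) )
    where
    Ln≤F : ∀ {x} → x ≤ L n → x ≤ F
    Ln≤F x≤Ln = ≤-trans x≤Ln (≤-trans (n≤1+n (L n)) (n≤1+n (suc (L n))))
    E≤F : E ≤ F
    E≤F = n≤1+n E

  crossings-length : length (crossings (τ n)) ≡ suc (suc n)
  crossings-length = cong (suc ∘ suc) (trans (cong length (twistCrossings≡ n)) (crossingsFrom-length 0 n))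

  stateLinks-count : ∀ st → length st ≡ suc (suc n) →
                     length (stateLinks (crossings (τ n)) st) ≡ edges (τ n)
  stateLinks-count st len = begin
    length (stateLinks (crossings (τ n)) st)
      ≡⟨ stateLinks-length (crossings (τ n)) st (trans len (sym crossings-length)) ⟩
    length (crossings (τ n)) + length (crossings (τ n))
      ≡⟨ cong₂ _+_ crossings-length crossings-length ⟩
    suc (suc n) + suc (suc n)
      ≡⟨ cong (suc ∘ suc) (trans (+-suc n (suc n)) (cong suc (+-suc n n))) ⟩
    edges (τ n) ∎
    where open ≡-Reasoning

  state-curves : ∀ s₁ s₂ s t → length t ≡ m →
    stateCurves (τ n) (s₁ ∷ s₂ ∷ s ∷ t) ≡ claspRedundant s₁ s₂ + twistCurves (claspPattern s₁ s₂) s t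
  state-curves s₁ s₂ s t len = begin
    stateCurves (τ n) (s₁ ∷ s₂ ∷ s ∷ t)
      ≡⟨ components≡redundant (edges (τ n)) (stateLinks (crossings (τ n)) st)
           (stateLinks-all (crossings (τ n)) st crossings-ends) (stateLinks-count st (cong (suc ∘ suc ∘ suc) len)) ⟩
    redundant id (split q s₁ ++ (split p s₂ ++ region))
      ≡⟨ cong (redundant id) (sym (++-assoc (split q s₁) (split p s₂) region)) ⟩
    redundant id (claspLinks s₁ s₂ ++ region)
      ≡⟨ redundant-++ id (claspLinks s₁ s₂) region ⟩
    redundant id (claspLinks s₁ s₂) + redundant (claspLabels s₁ s₂) region
      ≡⟨ cong₂ _+_ (clasp-redundant s₁ s₂) (cong (redundant (claspLabels s₁ s₂)) region≡) ⟩
    claspRedundant s₁ s₂ + redundant (claspLabels s₁ s₂) (links 0 (s ∷ t))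
      ≡⟨ cong (claspRedundant s₁ s₂ +_) (twist-redundant 0 (claspLabels s₁ s₂) (claspPattern s₁ s₂) s t
           (cong suc len) (clasp-fresh s₁ s₂) (clasp-pattern s₁ s₂)) ⟩
    claspRedundant s₁ s₂ + twistCurves (claspPattern s₁ s₂) s t ∎
    where
    open ≡-Reasoning
    st : List Bool
    st = s₁ ∷ s₂ ∷ s ∷ t
    region : List (ℕ × ℕ)
    region = stateLinks (twistCrossings n n) (s ∷ t)
    region≡ : region ≡ links 0 (s ∷ t)
    region≡ = cong (λ cs → stateLinks cs (s ∷ t)) (trans (twistCrossings≡ n) (cong (crossingsFrom 0 ∘ suc) (sym len)))

module StateSums where

  open TwistCrossing
  open import Data.Bool using (Bool; true; false)
  open import Data.Nat as ℕ using (zero; suc)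
  import Data.Nat.Properties as ℕP
  open import Data.Integer using (ℤ; +_; _+_; _*_; _-_; _^_; 1ℤ)
  open import Data.Integer.Properties using (+-assoc; +-identityˡ; +-identityʳ; ^-distribˡ-+-*)
  open import Data.Integer.Tactic.RingSolver using (solve-∀)
  open import Data.List using (List; []; _∷_; _++_; map; foldl; length)
  open import Data.List.Properties using (foldl-++; map-++; map-∘)
  open import Data.List.Relation.Unary.All using (All; []; _∷_)
  import Data.List.Relation.Unary.All as All
  open import Data.List.Relation.Unary.All.Properties using (++⁺; map⁺)
  open import Function using (_∘_)
  open import Relation.Binary.PropositionalEquality

  sumℤ-acc : ∀ a xs → foldl _+_ a xs ≡ a + sumℤ xs
  sumℤ-acc a []       = sym (+-identityʳ a)
  sumℤ-acc a (y ∷ xs) = begin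
    foldl _+_ (a + y) xs    ≡⟨ sumℤ-acc (a + y) xs ⟩
    a + y + sumℤ xs         ≡⟨ +-assoc a y (sumℤ xs) ⟩
    a + (y + sumℤ xs)       ≡⟨ cong (λ y′ → a + (y′ + sumℤ xs)) (sym (+-identityˡ y)) ⟩
    a + (+ 0 + y + sumℤ xs) ≡⟨ cong (λ z → a + z) (sym (sumℤ-acc (+ 0 + y) xs)) ⟩
    a + sumℤ (y ∷ xs)       ∎
    where open ≡-Reasoning

  sumℤ-++ : ∀ xs ys → sumℤ (xs ++ ys) ≡ sumℤ xs + sumℤ ys
  sumℤ-++ xs ys = trans (foldl-++ _+_ (+ 0) xs ys) (sumℤ-acc (sumℤ xs) ys)

  sumBool : (Bool → ℤ) → ℤ
  sumBool g = g true + g false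

  sumBool-cong : ∀ {g h : Bool → ℤ} → (∀ s → g s ≡ h s) → sumBool g ≡ sumBool h
  sumBool-cong g≗h = cong₂ _+_ (g≗h true) (g≗h false)

  sumStates : (List Bool → ℤ) → ℕ → ℤ
  sumStates g k = sumℤ (map g (allStates k))

  sumStates-suc : ∀ g k → sumStates g (suc k) ≡ sumBool (λ s → sumStates (g ∘ (s ∷_)) k)
  sumStates-suc g k = begin
    sumℤ (map g (map (true ∷_) (allStates k) ++ map (false ∷_) (allStates k)))
      ≡⟨ cong sumℤ (map-++ g (map (true ∷_) (allStates k)) _) ⟩
    sumℤ (map g (map (true ∷_) (allStates k)) ++ map g (map (false ∷_) (allStates k)))
      ≡⟨ sumℤ-++ (map g (map (true ∷_) (allStates k))) _ ⟩
    sumℤ (map g (map (true ∷_) (allStates k))) + sumℤ (map g (map (false ∷_) (allStates k)))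
      ≡⟨ sym (cong₂ _+_ (cong sumℤ (map-∘ (allStates k))) (cong sumℤ (map-∘ (allStates k)))) ⟩
    sumBool (λ s → sumStates (g ∘ (s ∷_)) k) ∎
    where open ≡-Reasoning

  allStates-length : ∀ k → All (λ t → length t ≡ k) (allStates k)
  allStates-length zero    = refl ∷ []
  allStates-length (suc k) = ++⁺ (map⁺ (All.map (cong suc) (allStates-length k)))
                                 (map⁺ (All.map (cong suc) (allStates-length k)))

  sumStates-cong : ∀ {g h} k → (∀ t → length t ≡ k → g t ≡ h t) → sumStates g k ≡ sumStates h k
  sumStates-cong {g} {h} k g≗h = cong sumℤ (go (allStates k) (allStates-length k))
    where
    go : ∀ ts → All (λ t → length t ≡ k) ts → map g ts ≡ map h ts
    go []       []         = refl
    go (t ∷ ts) (len ∷ ls) = cong₂ _∷_ (g≗h t len) (go ts ls)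

  -- x^c times the polynomial of a twist region with j + 1 crossings entered
  -- in pattern P.
  twistSum : Pattern → ℕ → ℕ → ℤ → ℤ
  twistSum P j c x = sumBool (λ s → sumStates (λ t → x ^ (c ℕ.+ twistCurves P s t)) j)

  twistSum-suc : ∀ P j c x → twistSum P (suc j) c x ≡ twistSum P j c x + twistSum capped j (c ℕ.+ gain P false) x
  twistSum-suc P j c x = begin
    sumBool (λ s → sumStates (λ t → x ^ (c ℕ.+ twistCurves P s t)) (suc j))
      ≡⟨ cong₂ _+_ (sumStates-suc _ j) (sumStates-suc _ j) ⟩
    sumBool (λ s → sumBool (λ s′ → sumStates (λ t → x ^ (c ℕ.+ (gain P s ℕ.+ twistCurves (next P s) s′ t))) j))
      ≡⟨ cong₂ _+_ (cong₂ _+_ (regroup true true) (regroup true false))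
                   (cong₂ _+_ (regroup false true) (regroup false false)) ⟩
    sumBool (λ s → twistSum (next P s) j (c ℕ.+ gain P s) x)
      ≡⟨ cong (λ c′ → twistSum P j c′ x + twistSum capped j (c ℕ.+ gain P false) x) (ℕP.+-identityʳ c) ⟩
    twistSum P j c x + twistSum capped j (c ℕ.+ gain P false) x ∎
    where
    open ≡-Reasoning
    regroup : ∀ s s′ → sumStates (λ t → x ^ (c ℕ.+ (gain P s ℕ.+ twistCurves (next P s) s′ t))) j
                     ≡ sumStates (λ t → x ^ (c ℕ.+ gain P s ℕ.+ twistCurves (next P s) s′ t)) j
    regroup s s′ = sumStates-cong j λ t _ → cong (x ^_) (sym (ℕP.+-assoc c (gain P s) _))

  twistPoly : Pattern → ℕ → ℤ → ℤ
  twistPoly through j x = x * x - 1ℤ + (1ℤ + x) ^ suc j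
  twistPoly capped  j x = x * (1ℤ + x) ^ suc j

  twistSum-closed : ∀ P j c x → twistSum P j c x ≡ x ^ c * twistPoly P j x
  twistSum-closed through zero c x
    rewrite ^-distribˡ-+-* x c 2 | ^-distribˡ-+-* x c 1 = one-through (x ^ c) x
    where
    one-through : ∀ X x → + 0 + X * (x * (x * 1ℤ)) + (+ 0 + X * (x * 1ℤ)) ≡ X * (x * x - 1ℤ + (1ℤ + x) * 1ℤ)
    one-through = solve-∀
  twistSum-closed capped  zero c x
    rewrite ^-distribˡ-+-* x c 1 | ^-distribˡ-+-* x c 2 = one-capped (x ^ c) x
    where
    one-capped : ∀ X x → + 0 + X * (x * 1ℤ) + (+ 0 + X * (x * (x * 1ℤ))) ≡ X * (x * ((1ℤ + x) * 1ℤ))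
    one-capped = solve-∀
  twistSum-closed through (suc j) c x
    rewrite twistSum-suc through j c x | twistSum-closed through j c x
          | twistSum-closed capped j (c ℕ.+ 0) x | ℕP.+-identityʳ c = step-through (x ^ c) x ((1ℤ + x) ^ suc j)
    where
    step-through : ∀ X x Y → X * (x * x - 1ℤ + Y) + X * (x * Y) ≡ X * (x * x - 1ℤ + (1ℤ + x) * Y)
    step-through = solve-∀
  twistSum-closed capped  (suc j) c x
    rewrite twistSum-suc capped j c x | twistSum-closed capped j c x
          | twistSum-closed capped j (c ℕ.+ 1) x | ^-distribˡ-+-* x c 1 = step-capped (x ^ c) x ((1ℤ + x) ^ suc j)
    where
    step-capped : ∀ X x Y → X * (x * Y) + X * (x * 1ℤ) * (x * Y) ≡ X * (x * ((1ℤ + x) * Y))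
    step-capped = solve-∀

module TwistKnotPolynomial (m : ℕ) where

  open TwistCrossing
  open TwistKnotStates m
  open Clasp m using (claspPattern; claspRedundant)
  open StateSums
  open import Data.Bool using (Bool)
  open import Data.Nat using (suc)
  open import Data.Integer using (ℤ; _^_)
  open import Data.List using (List; _∷_; length)
  open import Relation.Binary.PropositionalEquality

  genPoly-τ : ∀ x → genPoly (τ (suc m)) x ≡
    sumBool (λ s₁ → sumBool (λ s₂ → twistSum (claspPattern s₁ s₂) m (claspRedundant s₁ s₂) x))
  genPoly-τ x = begin
    sumStates curves (length (crossings (τ (suc m))))
      ≡⟨ cong (sumStates curves) crossings-length ⟩
    sumStates curves (suc (suc (suc m)))
      ≡⟨ sumStates-suc curves (suc (suc m)) ⟩
    sumBool (λ s₁ → sumStates (λ t → curves (s₁ ∷ t)) (suc (suc m)))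
      ≡⟨ sumBool-cong (λ s₁ → trans (sumStates-suc (λ t → curves (s₁ ∷ t)) (suc m)) (sumBool-cong λ s₂ →
           trans (sumStates-suc (λ t → curves (s₁ ∷ s₂ ∷ t)) m) (sumBool-cong λ s →
             sumStates-cong m λ t len → cong (x ^_) (state-curves s₁ s₂ s t len)))) ⟩
    sumBool (λ s₁ → sumBool (λ s₂ → twistSum (claspPattern s₁ s₂) m (claspRedundant s₁ s₂) x)) ∎
    where
    open ≡-Reasoning
    curves : List Bool → ℤ
    curves st = x ^ stateCurves (τ (suc m)) st

open import Data.Nat using (suc; zero)
open import Data.Integer using (ℤ; +_; _+_; _-_; _*_; _^_; 1ℤ)
open import Data.Integer.Tactic.RingSolver using (solve-∀)
open import Relation.Binary.PropositionalEquality using (_≡_; cong₂; module ≡-Reasoning)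
open TwistCrossing using (through; capped)
open StateSums using (twistSum; twistPoly; twistSum-closed)

mainTheorem1 : (n : ℕ) (x : ℤ) →
    genPoly (τ n) x ≡ (+ 2) * ((+ 1) + x) ^ suc n + x ^ 3 + (+ 2) * x ^ 2 - x - (+ 2)
-- τ 0: its four states have 2, 3, 1 and 2 curves, as evaluation shows.
mainTheorem1 zero x = τ₀ x
  where
  τ₀ : ∀ x → + 0 + x * (x * 1ℤ) + x * (x * (x * 1ℤ)) + x * 1ℤ + x * (x * 1ℤ)
           ≡ + 2 * ((+ 1 + x) * 1ℤ) + x * (x * (x * 1ℤ)) + + 2 * (x * (x * 1ℤ)) - x - + 2
  τ₀ = solve-∀
mainTheorem1 (suc m) x = begin
  genPoly (τ (suc m)) x
    ≡⟨ TwistKnotPolynomial.genPoly-τ m x ⟩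
  twistSum through m 0 x + twistSum through m 1 x + (twistSum capped m 0 x + twistSum through m 0 x)
    ≡⟨ cong₂ _+_ (cong₂ _+_ (twistSum-closed through m 0 x) (twistSum-closed through m 1 x))
                 (cong₂ _+_ (twistSum-closed capped m 0 x) (twistSum-closed through m 0 x)) ⟩
  x ^ 0 * twistPoly through m x + x ^ 1 * twistPoly through m x
    + (x ^ 0 * twistPoly capped m x + x ^ 0 * twistPoly through m x)
    ≡⟨ collect x ((1ℤ + x) ^ suc m) ⟩
  (+ 2) * ((+ 1) + x) ^ suc (suc m) + x ^ 3 + (+ 2) * x ^ 2 - x - (+ 2) ∎
  where
  open ≡-Reasoning
  collect : ∀ x Y → 1ℤ * (x * x - 1ℤ + Y) + (x * 1ℤ) * (x * x - 1ℤ + Y) + (1ℤ * (x * Y) + 1ℤ * (x * x - 1ℤ + Y))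
                  ≡ + 2 * ((+ 1 + x) * Y) + x * (x * (x * 1ℤ)) + + 2 * (x * (x * 1ℤ)) - x - + 2
  collect = solve-∀
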